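{- For every weight vector $\omega=(\omega_1,\omega_2,\ldots)$, in the formal power series ring $\mathbb{Q}[t_1,t_2,\ldots][[y]]$ one has $$\sum_{n\ge1}P_{n,\omega}\,y^n=\frac{\omega_1t_1y+\omega_2t_2y^2+\omega_3t_3y^3+\cdots}{1-p(y)},\qquad p(y)=t_1y+t_2y^2+t_3y^3+\cdots.$$
   Context: Let $t_1,t_2,\ldots$ be indeterminates (a finite number $k$ of them may be used by setting $t_j=0$ for $j>k$). For a finitely supported vector $\alpha$ of nonnegative integers write $t^\alpha=\prod_j t_j^{\alpha_j}$, $|\alpha|=\sum_j\alpha_j$, and $\alpha\vdash n$ if $\sum_j j\alpha_j=n$. For a rational weight vector $\omega$ define $A_\omega(e_j)=\omega_j$ ($e_j$ the $j$-th unit vector) and, for $|\alpha|\ge2$, $A_\omega(\alpha)=\sum_{j:\alpha_j\ge1}A_\omega(\alpha-e_j)$; the weighted isobaric polynomial of level $n$ and weight $\omega$ is $P_{n,\omega}=\sum_{\alpha\vdash n}A_\omega(\alpha)t^\alpha$. -}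

module Defs where

open import Data.Bool using (Bool; true; false; _∧_; if_then_else_; not)
open import Data.Nat as ℕ using (ℕ; zero; suc; _≡ᵇ_; _<ᵇ_)
open import Data.List using (List; []; _∷_; map; concatMap; upTo; filterᵇ; _++_; length; replicate; foldr)
open import Data.Product using (_×_; _,_)
open import Data.Rational using (ℚ; 0ℚ; 1ℚ; _+_; _*_; -_)
open import Relation.Binary.PropositionalEquality using (_≡_)

-- Monomials in t₁, t₂, … : a finitely supported exponent vector α,
-- represented as a list (α₁, α₂, …, α_k); missing entries are 0.
-- Two lists denote the same monomial iff they agree up to trailing zeros.

Monomial : Set
Monomial = List ℕ

isZero : ℕ → Bool
isZero zero    = true
isZero (suc _) = false

allZero : Monomial → Bool
allZero []       = true
allZero (a ∷ as) = isZero a ∧ allZero as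

sameMono : Monomial → Monomial → Bool
sameMono []       bs       = allZero bs
sameMono (a ∷ as) []       = allZero (a ∷ as)
sameMono (a ∷ as) (b ∷ bs) = (a ≡ᵇ b) ∧ sameMono as bs

mulMono : Monomial → Monomial → Monomial
mulMono []       bs       = bs
mulMono (a ∷ as) []       = a ∷ as
mulMono (a ∷ as) (b ∷ bs) = (a ℕ.+ b) ∷ mulMono as bs

size : Monomial → ℕ
size = foldr ℕ._+_ 0

levelFrom : ℕ → Monomial → ℕ
levelFrom j []       = 0
levelFrom j (a ∷ as) = j ℕ.* a ℕ.+ levelFrom (suc j) as

level : Monomial → ℕ
level = levelFrom 1

-- Polynomials in ℚ[t₁, t₂, …]: finite formal sums of terms q·t^α.
-- The polynomial is determined by its coefficient function; equality
-- of polynomials is equality of all coefficients.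

Poly : Set
Poly = List (ℚ × Monomial)

coeff : Poly → Monomial → ℚ
coeff []             β = 0ℚ
coeff ((q , α) ∷ p) β = (if sameMono α β then q else 0ℚ) + coeff p β

_≈P_ : Poly → Poly → Set
p ≈P q = ∀ β → coeff p β ≡ coeff q β

0P : Poly
0P = []

constP : ℚ → Poly
constP q = (q , []) ∷ []

_+P_ : Poly → Poly → Poly
p +P q = p ++ q

_*P_ : Poly → Poly → Poly
p *P q = concatMap (λ { (a , α) → map (λ { (b , β) → (a * b , mulMono α β) }) q }) p

scaleP : ℚ → Poly → Poly
scaleP c = map (λ { (a , α) → (c * a , α) })

negP : Poly → Poly
negP = scaleP (- 1ℚ)

-- the indeterminate t_j for j ≥ 1 (t 0 is the zero polynomial; unused)
t : ℕ → Poly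
t zero    = 0P
t (suc i) = (1ℚ , replicate i 0 ++ (1 ∷ [])) ∷ []

Series : Set
Series = ℕ → Poly

_≈S_ : Series → Series → Set
f ≈S g = ∀ n → f n ≈P g n

sumP : List Poly → Poly
sumP = foldr _+P_ 0P

_*S_ : Series → Series → Series
(f *S g) n = sumP (map (λ k → f k *P g (n ℕ.∸ k)) (upTo (suc n)))

oneS : Series
oneS zero    = constP 1ℚ
oneS (suc _) = 0P

_^S_ : Series → ℕ → Series
f ^S zero  = oneS
f ^S suc k = f *S (f ^S k)

-- For a series q with zero constant term, 1/(1 - q) = Σ_{k ≥ 0} q^k;
-- the coefficient of y^n only receives contributions from k ≤ n.
recipOneMinus : Series → Series
recipOneMinus q n = sumP (map (λ k → (q ^S k) n) (upTo (suc n)))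

Weight : Set
Weight = ℕ → ℚ          -- ω j = ω_j for j ≥ 1 (ω 0 unused)

-- decrease the entry at (0-based) position i by one
dec : ℕ → Monomial → Monomial
dec i       []       = []
dec zero    (a ∷ as) = a ℕ.∸ 1 ∷ as
dec (suc i) (a ∷ as) = a ∷ dec i as

lookup0 : Monomial → ℕ → ℕ
lookup0 []       _       = 0
lookup0 (a ∷ as) zero    = a
lookup0 (a ∷ as) (suc i) = lookup0 as i

-- 0-based positions i with α_{i+1} ≥ 1
support : Monomial → List ℕ
support α = filterᵇ (λ i → 0 <ᵇ lookup0 α i) (upTo (length α))

sumℚ : List ℚ → ℚ
sumℚ = foldr _+_ 0ℚ

Afuel : Weight → ℕ → Monomial → ℚ
Afuel ω zero    α = 0ℚ
Afuel ω (suc m) α =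
  if size α ≡ᵇ 1
  then sumℚ (map (λ i → ω (suc i)) (support α))       -- α = e_j : gives ω_j
  else sumℚ (map (λ i → Afuel ω m (dec i α)) (support α))

A : Weight → Monomial → ℚ
A ω α = Afuel ω (size α) α

vecs : ℕ → ℕ → List Monomial
vecs zero    b = [] ∷ []
vecs (suc l) b = concatMap (λ a → map (a ∷_) (vecs l b)) (upTo (suc b))

-- all α ⊢ n (each listed once, as a list of length n; for α ⊢ n one has
-- α_j = 0 for j > n and α_j ≤ n)
partitionsOf : ℕ → List Monomial
partitionsOf n = filterᵇ (λ α → level α ≡ᵇ n) (vecs n n)

P : ℕ → Weight → Poly
P n ω = map (λ α → (A ω α , α)) (partitionsOf n)

genP : Weight → Series
genP ω zero    = 0P
genP ω (suc n) = P (suc n) ω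

pS : Series
pS n = t n

numS : Weight → Series
numS ω zero    = 0P
numS ω (suc n) = scaleP (ω (suc n)) (t (suc n))

-- Write F = N/(1 − p) with N = Σ_j ω_j t_j y^j. Multiplication by a series of the
-- form Σ_j c_j t_j y^j acts on coefficients by G_n(β) ↦ Σ_{j : β_j ≥ 1} c_j G_{n−j}(β − e_j),
-- and two such operators commute. Hence 1/(1 − p) = 1 + p/(1 − p) gives F = N + pF, i.e.
--   [t^β yⁿ] F = Σ_{j : β_j ≥ 1} (ω_j [n = j, β = e_j] + [t^{β−e_j} y^{n−j}] F),
-- and by induction on n, [t^β yⁿ] F = 0 unless β ⊢ n. For β ⊢ n this is exactly the
-- recursion defining A_ω(β), so induction on |β| identifies [t^β yⁿ] F with A_ω(β).

module Submission where

open import Defs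
open import Algebra.Bundles using (CommutativeMonoid; CommutativeRing)
open import Data.Bool using (Bool; true; false; _∧_; if_then_else_; T)
open import Data.Bool.Properties using (∧-comm; ∧-zeroʳ; ∧-commutativeMonoid; T-∧)
open import Data.Fin using (toℕ)
open import Data.List using (List; []; _∷_; map; concatMap; upTo; applyUpTo; filterᵇ; _++_; length; replicate; drop)
open import Data.List.Properties using (map-cong)
open import Data.Fin.Properties using (toℕ<n; toℕ-inject₁; toℕ-fromℕ)
open import Data.Nat using (ℕ; zero; suc; _≡ᵇ_; _<ᵇ_; _∸_; _≤_; _<_; z≤n; s≤s)
import Data.Nat as ℕ
import Data.Nat.Properties as ℕₚ
open import Data.Nat.Tactic.RingSolver using (solve-∀)
open import Data.Nat.Induction using (<-rec)
open import Data.Product using (_,_; proj₁; proj₂)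
open import Data.Rational using (ℚ; 0ℚ; 1ℚ; _+_; _*_)
import Data.Rational.Properties as ℚₚ
open import Data.Sum using (inj₁; inj₂)
open import Function using (_∘_)
open import Function.Bundles using (Equivalence)
open import Relation.Binary.PropositionalEquality
open import Relation.Nullary using (contradiction)
open import Algebra.Properties.CommutativeSemigroup (CommutativeMonoid.commutativeSemigroup ∧-commutativeMonoid) using () renaming (x∙yz≈y∙xz to ∧-swap)
open import Algebra.Properties.CommutativeSemigroup (CommutativeMonoid.commutativeSemigroup ℚₚ.*-1-commutativeMonoid) using () renaming (x∙yz≈y∙xz to *-swap)
open import Algebra.Properties.Semiring.Sum (CommutativeRing.semiring ℚₚ.+-*-commutativeRing) using (sum; sum-cong-≗; sum-replicate-zero; ∑-distrib-+; ∑-comm; *-distribˡ-sum; sum-init-last)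

open ≡-Reasoning

when : Bool → ℚ → ℚ
when b x = if b then x else 0ℚ

when-0 : ∀ b → when b 0ℚ ≡ 0ℚ
when-0 true  = refl
when-0 false = refl

when-∧ : ∀ a b x → when (a ∧ b) x ≡ when a (when b x)
when-∧ true  b x = refl
when-∧ false b x = refl

when-+ : ∀ b x y → when b (x + y) ≡ when b x + when b y
when-+ true  x y = refl
when-+ false x y = sym (ℚₚ.+-identityʳ 0ℚ)

*-when : ∀ b c x → c * when b x ≡ when b (c * x)
*-when true  c x = refl
*-when false c x = ℚₚ.*-zeroʳ c

when-congᵗ : ∀ b {x y} → (T b → x ≡ y) → when b x ≡ when b y
when-congᵗ true  x≡y = x≡y _
when-congᵗ false x≡y = refl

when-absorb : ∀ a b x → (T b → T a) → when a (when b x) ≡ when b x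
when-absorb true  b     x _   = refl
when-absorb false false x _   = refl
when-absorb false true  x b⇒a = contradiction (b⇒a _) λ ()

when-≡0 : ∀ b {x} → (T b → x ≡ 0ℚ) → when b x ≡ 0ℚ
when-≡0 b x≡0 = trans (when-congᵗ b x≡0) (when-0 b)

Bool-ext : ∀ {x y} → (T x → T y) → (T y → T x) → x ≡ y
Bool-ext {false} {false} _   _   = refl
Bool-ext {false} {true}  _   y⇒x = contradiction (y⇒x _) λ ()
Bool-ext {true}  {false} x⇒y _   = contradiction (x⇒y _) λ ()
Bool-ext {true}  {true}  _   _   = refl

∑< : ℕ → (ℕ → ℚ) → ℚ
∑< n f = sum {n} (f ∘ toℕ)

syntax ∑< n (λ k → x) = ∑[ k < n ] x

∑<-cong : ∀ n {f g : ℕ → ℚ} → (∀ k → k < n → f k ≡ g k) → ∑< n f ≡ ∑< n g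
∑<-cong n f≡g = sum-cong-≗ (λ i → f≡g (toℕ i) (toℕ<n i))

∑<-zero : ∀ n {f : ℕ → ℚ} → (∀ k → k < n → f k ≡ 0ℚ) → ∑< n f ≡ 0ℚ
∑<-zero n f≡0 = trans (∑<-cong n f≡0) (sum-replicate-zero n)

∑<-+ : ∀ n (f g : ℕ → ℚ) → ∑[ k < n ] (f k + g k) ≡ ∑< n f + ∑< n g
∑<-+ n f g = ∑-distrib-+ {n} (f ∘ toℕ) (g ∘ toℕ)

*-distribˡ-∑< : ∀ n c (f : ℕ → ℚ) → c * ∑< n f ≡ ∑[ k < n ] (c * f k)
*-distribˡ-∑< n c f = *-distribˡ-sum {n} c (f ∘ toℕ)

∑<-comm : ∀ m n (F : ℕ → ℕ → ℚ) → ∑[ k < m ] ∑< n (F k) ≡ ∑[ j < n ] ∑[ k < m ] F k j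
∑<-comm m n F = ∑-comm {m} {n} (λ i j → F (toℕ i) (toℕ j))

∑<-last : ∀ n (f : ℕ → ℚ) → ∑< (suc n) f ≡ ∑< n f + f n
∑<-last n f = trans (sum-init-last {n} (f ∘ toℕ))
  (cong₂ _+_ (sum-cong-≗ {n} (cong f ∘ toℕ-inject₁)) (cong f (toℕ-fromℕ n)))

when-∑< : ∀ b n (f : ℕ → ℚ) → when b (∑< n f) ≡ ∑[ k < n ] when b (f k)
when-∑< true  n f = refl
when-∑< false n f = sym (∑<-zero n (λ _ _ → refl))

∑<-triangle : ∀ n (F : ℕ → ℕ → ℚ) →
              ∑[ k < n ] ∑< (n ∸ suc k) (F k) ≡ ∑[ j < n ] ∑[ k < n ∸ suc j ] F k j
∑<-triangle zero    F = refl
∑<-triangle (suc n) F = begin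
  ∑< n (F 0) + ∑[ k < n ] ∑< (n ∸ suc k) (F (suc k))
    ≡⟨ cong (∑< n (F 0) +_) (∑<-triangle n (F ∘ suc)) ⟩
  ∑< n (F 0) + ∑[ j < n ] ∑[ k < n ∸ suc j ] F (suc k) j
    ≡⟨ sym (∑<-+ n (F 0) (λ j → ∑[ k < n ∸ suc j ] F (suc k) j)) ⟩
  ∑[ j < n ] (F 0 j + ∑[ k < n ∸ suc j ] F (suc k) j)
    ≡⟨ ∑<-cong n (λ j j<n → cong (λ m → ∑[ k < m ] F k j) (sym (ℕₚ.+-∸-assoc 1 j<n))) ⟩
  ∑[ j < n ] ∑[ k < n ∸ j ] F k j
    ≡⟨ sym (ℚₚ.+-identityʳ _) ⟩
  ∑[ j < n ] ∑[ k < n ∸ j ] F k j + 0ℚ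
    ≡⟨ cong (λ m → ∑[ j < n ] ∑[ k < n ∸ j ] F k j + ∑[ k < m ] F k n) (sym (ℕₚ.n∸n≡0 n)) ⟩
  ∑[ j < n ] ∑[ k < n ∸ j ] F k j + ∑[ k < n ∸ n ] F k n
    ≡⟨ sym (∑<-last n (λ j → ∑[ k < n ∸ j ] F k j)) ⟩
  ∑[ j < suc n ] ∑[ k < suc n ∸ suc j ] F k j ∎

∑<-extend : ∀ n M {f : ℕ → ℚ} → n ≤ M → (∀ k → n ≤ k → f k ≡ 0ℚ) → ∑< M f ≡ ∑< n f
∑<-extend zero    M       n≤M       f≡0 = ∑<-zero M (λ k _ → f≡0 k z≤n)
∑<-extend (suc n) (suc M) {f} (s≤s n≤M) f≡0 = cong (f 0 +_) (∑<-extend n M n≤M (λ k → f≡0 (suc k) ∘ s≤s))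

∑<-bounded : ∀ m n {f : ℕ → ℚ} → (∀ k → m ≤ k → f k ≡ 0ℚ) → (∀ k → n ≤ k → f k ≡ 0ℚ) →
             ∑< m f ≡ ∑< n f
∑<-bounded m n f≡0₁ f≡0₂ with ℕₚ.≤-total m n
... | inj₁ m≤n = sym (∑<-extend m n m≤n f≡0₁)
... | inj₂ n≤m = ∑<-extend n m n≤m f≡0₂

∑<-indicator : ∀ M c (g : ℕ → ℚ) → ∑[ a < M ] when (a ≡ᵇ c) (g a) ≡ when (c <ᵇ M) (g c)
∑<-indicator zero    c       g = refl
∑<-indicator (suc M) zero    g = trans (cong (g 0 +_) (∑<-zero M (λ _ _ → refl))) (ℚₚ.+-identityʳ (g 0))
∑<-indicator (suc M) (suc c) g = trans (ℚₚ.+-identityˡ _) (∑<-indicator M c (g ∘ suc))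

∸-suc< : ∀ {j n} → j < n → n ∸ suc j < n
∸-suc< j<n = ℕₚ.∸-monoʳ-< ℕ.z<s j<n

∑ˡ : {X : Set} → List X → (X → ℚ) → ℚ
∑ˡ xs f = sumℚ (map f xs)

∑ˡ-cong : {X : Set} (xs : List X) {f g : X → ℚ} → (∀ x → f x ≡ g x) → ∑ˡ xs f ≡ ∑ˡ xs g
∑ˡ-cong []       f≡g = refl
∑ˡ-cong (x ∷ xs) f≡g = cong₂ _+_ (f≡g x) (∑ˡ-cong xs f≡g)

∑ˡ-++ : {X : Set} (xs ys : List X) (f : X → ℚ) → ∑ˡ (xs ++ ys) f ≡ ∑ˡ xs f + ∑ˡ ys f
∑ˡ-++ []       ys f = sym (ℚₚ.+-identityˡ _)
∑ˡ-++ (x ∷ xs) ys f = trans (cong (f x +_) (∑ˡ-++ xs ys f)) (sym (ℚₚ.+-assoc (f x) _ _))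

∑ˡ-map : {X Y : Set} (g : X → Y) (xs : List X) (f : Y → ℚ) → ∑ˡ (map g xs) f ≡ ∑ˡ xs (f ∘ g)
∑ˡ-map g []       f = refl
∑ˡ-map g (x ∷ xs) f = cong (f (g x) +_) (∑ˡ-map g xs f)

∑ˡ-concatMap : {X Y : Set} (g : X → List Y) (xs : List X) (f : Y → ℚ) →
               ∑ˡ (concatMap g xs) f ≡ ∑ˡ xs (λ x → ∑ˡ (g x) f)
∑ˡ-concatMap g []       f = refl
∑ˡ-concatMap g (x ∷ xs) f = trans (∑ˡ-++ (g x) (concatMap g xs) f) (cong (∑ˡ (g x) f +_) (∑ˡ-concatMap g xs f))

∑ˡ-filterᵇ : {X : Set} (p : X → Bool) (xs : List X) (f : X → ℚ) →
             ∑ˡ (filterᵇ p xs) f ≡ ∑ˡ xs (λ x → when (p x) (f x))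
∑ˡ-filterᵇ p []       f = refl
∑ˡ-filterᵇ p (x ∷ xs) f with p x
... | true  = cong (f x +_) (∑ˡ-filterᵇ p xs f)
... | false = trans (∑ˡ-filterᵇ p xs f) (sym (ℚₚ.+-identityˡ _))

∑ˡ-applyUpTo : {X : Set} (g : ℕ → X) (n : ℕ) (f : X → ℚ) → ∑ˡ (applyUpTo g n) f ≡ ∑< n (f ∘ g)
∑ˡ-applyUpTo g zero    f = refl
∑ˡ-applyUpTo g (suc n) f = cong (f (g 0) +_) (∑ˡ-applyUpTo (g ∘ suc) n f)

when-∑ˡ : {X : Set} (b : Bool) (xs : List X) (f : X → ℚ) → when b (∑ˡ xs f) ≡ ∑ˡ xs (λ x → when b (f x))
when-∑ˡ true  xs f = refl
when-∑ˡ false xs f = sym (zero-sum xs)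
  where
    zero-sum : ∀ xs → ∑ˡ xs (λ _ → 0ℚ) ≡ 0ℚ
    zero-sum []       = refl
    zero-sum (x ∷ xs) = trans (ℚₚ.+-identityˡ _) (zero-sum xs)

-- Positions are 0-based: the index i stands for the variable t_{i+1}.
unit : ℕ → Monomial
unit i = replicate i 0 ++ 1 ∷ []

hasVar : ℕ → Monomial → Bool
hasVar i β = 0 <ᵇ lookup0 β i

sameMono-[] : ∀ α → sameMono α [] ≡ allZero α
sameMono-[] []      = refl
sameMono-[] (a ∷ α) = refl

mulMono-[] : ∀ α → mulMono α [] ≡ α
mulMono-[] []      = refl
mulMono-[] (a ∷ α) = refl

allZero-unit : ∀ i → allZero (unit i) ≡ false
allZero-unit zero    = refl
allZero-unit (suc i) = allZero-unit i

sameMono-mulMono-unit : ∀ i δ γ → sameMono (mulMono (unit i) δ) γ ≡ hasVar i γ ∧ sameMono δ (dec i γ)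
sameMono-mulMono-unit zero    []      []                  = refl
sameMono-mulMono-unit zero    []      (zero ∷ γ)          = refl
sameMono-mulMono-unit zero    []      (suc zero ∷ γ)      = refl
sameMono-mulMono-unit zero    []      (suc (suc c) ∷ γ)   = refl
sameMono-mulMono-unit zero    (d ∷ δ) []                  = refl
sameMono-mulMono-unit zero    (d ∷ δ) (zero ∷ γ)          = refl
sameMono-mulMono-unit zero    (d ∷ δ) (suc c ∷ γ)         = refl
sameMono-mulMono-unit (suc i) []      []                  = allZero-unit i
sameMono-mulMono-unit (suc i) []      (zero ∷ γ)          =
  trans (cong (λ μ → sameMono μ γ) (sym (mulMono-[] (unit i)))) (sameMono-mulMono-unit i [] γ)
sameMono-mulMono-unit (suc i) []      (suc c ∷ γ)         = sym (∧-zeroʳ (hasVar i γ))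
sameMono-mulMono-unit (suc i) (d ∷ δ) []                  =
  trans (cong (isZero d ∧_) (trans (sym (sameMono-[] (mulMono (unit i) δ))) (sameMono-mulMono-unit i δ [])))
        (∧-zeroʳ (isZero d))
sameMono-mulMono-unit (suc i) (d ∷ δ) (c ∷ γ)             =
  trans (cong ((d ≡ᵇ c) ∧_) (sameMono-mulMono-unit i δ γ)) (∧-swap (d ≡ᵇ c) (hasVar i γ) _)

dec-comm : ∀ i j β → dec i (dec j β) ≡ dec j (dec i β)
dec-comm i       j       []      = refl
dec-comm zero    zero    (b ∷ β) = refl
dec-comm zero    (suc j) (b ∷ β) = refl
dec-comm (suc i) zero    (b ∷ β) = refl
dec-comm (suc i) (suc j) (b ∷ β) = cong (b ∷_) (dec-comm i j β)

hasVar-dec-comm : ∀ i j β → hasVar i β ∧ hasVar j (dec i β) ≡ hasVar j β ∧ hasVar i (dec j β)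
hasVar-dec-comm i       j       []      = refl
hasVar-dec-comm zero    zero    (b ∷ β) = refl
hasVar-dec-comm zero    (suc j) (b ∷ β) = ∧-comm (0 <ᵇ b) (hasVar j β)
hasVar-dec-comm (suc i) zero    (b ∷ β) = ∧-comm (hasVar i β) (0 <ᵇ b)
hasVar-dec-comm (suc i) (suc j) (b ∷ β) = hasVar-dec-comm i j β

size-dec : ∀ i α → T (hasVar i α) → suc (size (dec i α)) ≡ size α
size-dec zero    (suc a ∷ α) _  = refl
size-dec (suc i) (a ∷ α)     hv = trans (sym (ℕₚ.+-suc a _)) (cong (a ℕ.+_) (size-dec i α hv))

allZero-size : ∀ α → allZero α ≡ (size α ≡ᵇ 0)
allZero-size []          = refl
allZero-size (zero ∷ α)  = allZero-size α
allZero-size (suc a ∷ α) = refl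

levelFrom-dec : ∀ i j α → T (hasVar i α) → levelFrom j (dec i α) ℕ.+ (j ℕ.+ i) ≡ levelFrom j α
levelFrom-dec zero    j (suc a ∷ α) _  = shuffle j a (levelFrom (suc j) α)
  where
    shuffle : ∀ j a l → j ℕ.* a ℕ.+ l ℕ.+ (j ℕ.+ 0) ≡ j ℕ.* suc a ℕ.+ l
    shuffle = solve-∀
levelFrom-dec (suc i) j (a ∷ α)     hv = begin
  j ℕ.* a ℕ.+ levelFrom (suc j) (dec i α) ℕ.+ (j ℕ.+ suc i)
    ≡⟨ cong (j ℕ.* a ℕ.+ levelFrom (suc j) (dec i α) ℕ.+_) (ℕₚ.+-suc j i) ⟩
  j ℕ.* a ℕ.+ levelFrom (suc j) (dec i α) ℕ.+ (suc j ℕ.+ i)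
    ≡⟨ ℕₚ.+-assoc (j ℕ.* a) _ _ ⟩
  j ℕ.* a ℕ.+ (levelFrom (suc j) (dec i α) ℕ.+ (suc j ℕ.+ i))
    ≡⟨ cong (j ℕ.* a ℕ.+_) (levelFrom-dec i (suc j) α hv) ⟩
  j ℕ.* a ℕ.+ levelFrom (suc j) α ∎

level-dec : ∀ i α → T (hasVar i α) → level (dec i α) ℕ.+ suc i ≡ level α
level-dec i = levelFrom-dec i 1

level-dec-∸ : ∀ i α → T (hasVar i α) → level (dec i α) ≡ level α ∸ suc i
level-dec-∸ i α hv = trans (sym (ℕₚ.m+n∸n≡m (level (dec i α)) (suc i))) (cong (_∸ suc i) (level-dec i α hv))

hasVar⇒<level : ∀ i α → T (hasVar i α) → i < level α
hasVar⇒<level i α hv = ℕₚ.≤-trans (ℕₚ.m≤n+m (suc i) _) (ℕₚ.≤-reflexive (level-dec i α hv))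

hasVar⇒<length : ∀ i α → T (hasVar i α) → i < length α
hasVar⇒<length zero    (a ∷ α) _  = s≤s z≤n
hasVar⇒<length (suc i) (a ∷ α) hv = s≤s (hasVar⇒<length i α hv)

allZero⇒levelFrom≡0 : ∀ j α → T (allZero α) → levelFrom j α ≡ 0
allZero⇒levelFrom≡0 j []         _  = refl
allZero⇒levelFrom≡0 j (zero ∷ α) az =
  trans (cong (ℕ._+ levelFrom (suc j) α) (ℕₚ.*-zeroʳ j)) (allZero⇒levelFrom≡0 (suc j) α az)

size≡0⇒level≡0 : ∀ α → size α ≡ 0 → level α ≡ 0
size≡0⇒level≡0 α size≡0 =
  allZero⇒levelFrom≡0 1 α (subst T (sym (trans (allZero-size α) (cong (_≡ᵇ 0) size≡0))) _)

sameMono-∷ : ∀ a α β → sameMono (a ∷ α) β ≡ (a ≡ᵇ lookup0 β 0) ∧ sameMono α (drop 1 β)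
sameMono-∷ zero    α []      = sym (sameMono-[] α)
sameMono-∷ (suc a) α []      = refl
sameMono-∷ a       α (b ∷ β) = refl

allZero-lookup0 : ∀ β i → T (allZero β) → lookup0 β i ≡ 0
allZero-lookup0 []         i       _  = refl
allZero-lookup0 (zero ∷ β) zero    _  = refl
allZero-lookup0 (zero ∷ β) (suc i) az = allZero-lookup0 β i az

sameMono⇒lookup0 : ∀ α β → T (sameMono α β) → ∀ i → lookup0 α i ≡ lookup0 β i
sameMono⇒lookup0 []      β       same i       = sym (allZero-lookup0 β i same)
sameMono⇒lookup0 (a ∷ α) []      same i       = allZero-lookup0 (a ∷ α) i same
sameMono⇒lookup0 (a ∷ α) (b ∷ β) same zero    = ℕₚ.≡ᵇ⇒≡ a b (proj₁ (Equivalence.to T-∧ same))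
sameMono⇒lookup0 (a ∷ α) (b ∷ β) same (suc i) = sameMono⇒lookup0 α β (proj₂ (Equivalence.to T-∧ same)) i

lookup0⇒sameMono : ∀ α β → (∀ i → lookup0 α i ≡ lookup0 β i) → T (sameMono α β)
lookup0⇒sameMono []      []      _  = _
lookup0⇒sameMono []      (b ∷ β) eq with refl ← eq 0 = lookup0⇒sameMono [] β (eq ∘ suc)
lookup0⇒sameMono (a ∷ α) []      eq with refl ← eq 0 =
  subst T (sameMono-[] α) (lookup0⇒sameMono α [] (eq ∘ suc))
lookup0⇒sameMono (a ∷ α) (b ∷ β) eq with refl ← eq 0 =
  Equivalence.from T-∧ (ℕₚ.≡⇒≡ᵇ a a refl , lookup0⇒sameMono α β (eq ∘ suc))

sameMono-congʳ : ∀ α {β β′} → T (sameMono β β′) → sameMono α β ≡ sameMono α β′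
sameMono-congʳ α {β} {β′} same = Bool-ext
  (λ s → lookup0⇒sameMono α β′ λ i → trans (sameMono⇒lookup0 α β s i) (sameMono⇒lookup0 β β′ same i))
  (λ s → lookup0⇒sameMono α β λ i → trans (sameMono⇒lookup0 α β′ s i) (sym (sameMono⇒lookup0 β β′ same i)))

levelFrom-cong : ∀ j α β → T (sameMono α β) → levelFrom j α ≡ levelFrom j β
levelFrom-cong j []      β       same = sym (allZero⇒levelFrom≡0 j β same)
levelFrom-cong j (a ∷ α) []      same = allZero⇒levelFrom≡0 j (a ∷ α) same
levelFrom-cong j (a ∷ α) (b ∷ β) same = cong₂ (λ x y → j ℕ.* x ℕ.+ y)
  (ℕₚ.≡ᵇ⇒≡ a b (proj₁ (Equivalence.to T-∧ same)))
  (levelFrom-cong (suc j) α β (proj₂ (Equivalence.to T-∧ same)))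

coeff-++ : ∀ p q β → coeff (p ++ q) β ≡ coeff p β + coeff q β
coeff-++ []            q β = sym (ℚₚ.+-identityˡ _)
coeff-++ ((a , α) ∷ p) q β = trans (cong (when (sameMono α β) a +_) (coeff-++ p q β))
                                   (sym (ℚₚ.+-assoc (when (sameMono α β) a) (coeff p β) (coeff q β)))

coeff-sumP : {X : Set} (g : X → Poly) (xs : List X) (β : Monomial) →
             coeff (sumP (map g xs)) β ≡ ∑ˡ xs (λ x → coeff (g x) β)
coeff-sumP g []       β = refl
coeff-sumP g (x ∷ xs) β = trans (coeff-++ (g x) _ β) (cong (coeff (g x) β +_) (coeff-sumP g xs β))

coeff-terms : (h : Monomial → ℚ) (αs : List Monomial) (β : Monomial) →
              coeff (map (λ α → (h α , α)) αs) β ≡ ∑ˡ αs (λ α → when (sameMono α β) (h α))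
coeff-terms h []       β = refl
coeff-terms h (α ∷ αs) β = cong (when (sameMono α β) (h α) +_) (coeff-terms h αs β)

coeff-congʳ : ∀ p {β β′} → T (sameMono β β′) → coeff p β ≡ coeff p β′
coeff-congʳ []            same = refl
coeff-congʳ ((a , α) ∷ p) same = cong₂ _+_ (cong (λ s → when s a) (sameMono-congʳ α same)) (coeff-congʳ p same)

coeff-unit-*P : ∀ c i q γ → coeff (((c , unit i) ∷ []) *P q) γ ≡ when (hasVar i γ) (c * coeff q (dec i γ))
coeff-unit-*P c i []            γ = sym (trans (cong (when (hasVar i γ)) (ℚₚ.*-zeroʳ c)) (when-0 (hasVar i γ)))
coeff-unit-*P c i ((b , δ) ∷ q) γ = begin
  when (sameMono (mulMono (unit i) δ) γ) (c * b) + coeff (((c , unit i) ∷ []) *P q) γ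
    ≡⟨ cong₂ _+_ (cong (λ s → when s (c * b)) (sameMono-mulMono-unit i δ γ)) (coeff-unit-*P c i q γ) ⟩
  when (v ∧ s) (c * b) + when v (c * coeff q δ′)
    ≡⟨ cong (_+ when v (c * coeff q δ′)) (when-∧ v s (c * b)) ⟩
  when v (when s (c * b)) + when v (c * coeff q δ′)
    ≡⟨ sym (when-+ v _ _) ⟩
  when v (when s (c * b) + c * coeff q δ′)
    ≡⟨ cong (λ x → when v (x + c * coeff q δ′)) (sym (*-when s c b)) ⟩
  when v (c * when s b + c * coeff q δ′)
    ≡⟨ cong (when v) (sym (ℚₚ.*-distribˡ-+ c (when s b) (coeff q δ′))) ⟩
  when v (c * (when s b + coeff q δ′)) ∎
  where
    v  = hasVar i γ
    δ′ = dec i γ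
    s  = sameMono δ δ′

Coeffs : Set
Coeffs = ℕ → Monomial → ℚ

coeffs : Series → Coeffs
coeffs f n β = coeff (f n) β

oneCoeffs : Coeffs
oneCoeffs zero    β = when (allZero β) 1ℚ
oneCoeffs (suc _) β = 0ℚ

coeffs-oneS : ∀ m β → coeffs oneS m β ≡ oneCoeffs m β
coeffs-oneS zero    β = ℚₚ.+-identityʳ _
coeffs-oneS (suc m) β = refl

linearSeries : (ℕ → ℚ) → Series
linearSeries c zero    = 0P
linearSeries c (suc j) = (c j , unit j) ∷ []

pS-linear : ∀ k → pS k ≡ linearSeries (λ _ → 1ℚ) k
pS-linear zero    = refl
pS-linear (suc j) = refl

numS-linear : ∀ ω k → numS ω k ≡ linearSeries (ω ∘ suc) k
numS-linear ω zero    = refl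
numS-linear ω (suc j) = cong (λ x → (x , unit j) ∷ []) (ℚₚ.*-identityʳ (ω (suc j)))

-- The coefficients of (Σ_j c_j t_{j+1} y^{j+1}) · G.
mulLinear : (ℕ → ℚ) → Coeffs → Coeffs
mulLinear c G n β = ∑[ j < n ] when (hasVar j β) (c j * G (n ∸ suc j) (dec j β))

*S-congˡ : ∀ {f f′} → (∀ k → f k ≡ f′ k) → ∀ g n → (f *S g) n ≡ (f′ *S g) n
*S-congˡ f≗f′ g n = cong sumP (map-cong (λ k → cong (_*P g (n ∸ k)) (f≗f′ k)) (upTo (suc n)))

coeffs-linearSeries-*S : ∀ c g n β → coeffs (linearSeries c *S g) n β ≡ mulLinear c (coeffs g) n β
coeffs-linearSeries-*S c g n β = begin
  coeff (sumP (map (λ k → linearSeries c k *P g (n ∸ k)) (upTo (suc n)))) β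
    ≡⟨ coeff-sumP (λ k → linearSeries c k *P g (n ∸ k)) (upTo (suc n)) β ⟩
  ∑ˡ (upTo (suc n)) (λ k → coeff (linearSeries c k *P g (n ∸ k)) β)
    ≡⟨ ∑ˡ-applyUpTo (λ k → k) (suc n) (λ k → coeff (linearSeries c k *P g (n ∸ k)) β) ⟩
  0ℚ + ∑[ j < n ] coeff (((c j , unit j) ∷ []) *P g (n ∸ suc j)) β
    ≡⟨ ℚₚ.+-identityˡ _ ⟩
  ∑[ j < n ] coeff (((c j , unit j) ∷ []) *P g (n ∸ suc j)) β
    ≡⟨ ∑<-cong n (λ j _ → coeff-unit-*P (c j) j (g (n ∸ suc j)) β) ⟩
  mulLinear c (coeffs g) n β ∎

mulLinear-cong : ∀ c {G H : Coeffs} n β → (∀ m γ → m < n → G m γ ≡ H m γ) →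
                 mulLinear c G n β ≡ mulLinear c H n β
mulLinear-cong c n β G≡H = ∑<-cong n (λ j j<n →
  cong (λ x → when (hasVar j β) (c j * x)) (G≡H (n ∸ suc j) (dec j β) (∸-suc< j<n)))

mulLinear-+ : ∀ c (G H : Coeffs) n β →
              mulLinear c (λ m γ → G m γ + H m γ) n β ≡ mulLinear c G n β + mulLinear c H n β
mulLinear-+ c G H n β = trans (∑<-cong n (λ j _ →
    trans (cong (when (v j)) (ℚₚ.*-distribˡ-+ (c j) (G (n ∸ suc j) (δ j)) (H (n ∸ suc j) (δ j))))
          (when-+ (v j) (c j * G (n ∸ suc j) (δ j)) (c j * H (n ∸ suc j) (δ j)))))
  (∑<-+ n (λ j → when (v j) (c j * G (n ∸ suc j) (δ j))) (λ j → when (v j) (c j * H (n ∸ suc j) (δ j))))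
  where
    v : ℕ → Bool
    v j = hasVar j β
    δ : ℕ → Monomial
    δ j = dec j β

mulLinear-∑ : ∀ c M (G : ℕ → Coeffs) n β →
              mulLinear c (λ m γ → ∑[ k < M ] G k m γ) n β ≡ ∑[ k < M ] mulLinear c (G k) n β
mulLinear-∑ c M G n β = trans (∑<-cong n (λ j _ →
    trans (cong (when (hasVar j β)) (*-distribˡ-∑< M (c j) (λ k → G k (n ∸ suc j) (dec j β))))
          (when-∑< (hasVar j β) M (λ k → c j * G k (n ∸ suc j) (dec j β)))))
  (∑<-comm n M (λ j k → when (hasVar j β) (c j * G k (n ∸ suc j) (dec j β))))

mulLinear-twice : ∀ c d G n β → mulLinear c (mulLinear d G) n β ≡
  ∑[ k < n ] ∑[ j < n ∸ suc k ] when (hasVar k β ∧ hasVar j (dec k β))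
                                     (c k * (d j * G (n ∸ suc k ∸ suc j) (dec j (dec k β))))
mulLinear-twice c d G n β = ∑<-cong n (λ k _ → expand k)
  where
    expand : ∀ k → when (hasVar k β) (c k * mulLinear d G (n ∸ suc k) (dec k β)) ≡
      ∑[ j < n ∸ suc k ] when (hasVar k β ∧ hasVar j (dec k β))
                              (c k * (d j * G (n ∸ suc k ∸ suc j) (dec j (dec k β))))
    expand k = begin
      when v (c k * ∑[ j < m ] when (w j) (d j * G′ j))
        ≡⟨ cong (when v) (*-distribˡ-∑< m (c k) (λ j → when (w j) (d j * G′ j))) ⟩
      when v (∑[ j < m ] (c k * when (w j) (d j * G′ j)))
        ≡⟨ cong (when v) (∑<-cong m (λ j _ → *-when (w j) (c k) (d j * G′ j))) ⟩
      when v (∑[ j < m ] when (w j) (c k * (d j * G′ j)))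
        ≡⟨ when-∑< v m (λ j → when (w j) (c k * (d j * G′ j))) ⟩
      ∑[ j < m ] when v (when (w j) (c k * (d j * G′ j)))
        ≡⟨ ∑<-cong m (λ j _ → sym (when-∧ v (w j) (c k * (d j * G′ j)))) ⟩
      ∑[ j < m ] when (v ∧ w j) (c k * (d j * G′ j)) ∎
      where
        v = hasVar k β
        m = n ∸ suc k
        w : ℕ → Bool
        w j = hasVar j (dec k β)
        G′ : ℕ → ℚ
        G′ j = G (m ∸ suc j) (dec j (dec k β))

mulLinear-comm : ∀ c d G n β → mulLinear c (mulLinear d G) n β ≡ mulLinear d (mulLinear c G) n β
mulLinear-comm c d G n β = begin
  mulLinear c (mulLinear d G) n β
    ≡⟨ mulLinear-twice c d G n β ⟩
  ∑[ k < n ] ∑< (n ∸ suc k) (term c d k)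
    ≡⟨ ∑<-triangle n (term c d) ⟩
  ∑[ j < n ] ∑[ k < n ∸ suc j ] term c d k j
    ≡⟨ ∑<-cong n (λ j _ → ∑<-cong (n ∸ suc j) (λ k _ → term-swap k j)) ⟩
  ∑[ j < n ] ∑< (n ∸ suc j) (term d c j)
    ≡⟨ sym (mulLinear-twice d c G n β) ⟩
  mulLinear d (mulLinear c G) n β ∎
  where
    term : (ℕ → ℚ) → (ℕ → ℚ) → ℕ → ℕ → ℚ
    term c d k j = when (hasVar k β ∧ hasVar j (dec k β))
                        (c k * (d j * G (n ∸ suc k ∸ suc j) (dec j (dec k β))))
    ∸-comm : ∀ a b → n ∸ a ∸ b ≡ n ∸ b ∸ a
    ∸-comm a b = trans (ℕₚ.∸-+-assoc n a b) (trans (cong (n ∸_) (ℕₚ.+-comm a b)) (sym (ℕₚ.∸-+-assoc n b a)))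
    term-swap : ∀ k j → term c d k j ≡ term d c j k
    term-swap k j = cong₂ when (hasVar-dec-comm k j β)
      (trans (*-swap (c k) (d j) _)
             (cong₂ (λ m γ → d j * (c k * G m γ)) (∸-comm (suc k) (suc j)) (dec-comm j k β)))

IsobaricAt : Coeffs → ℕ → Set
IsobaricAt G m = ∀ γ → level γ ≢ m → G m γ ≡ 0ℚ

isobaric-when : ∀ {G n} → IsobaricAt G n → ∀ β → when (level β ≡ᵇ n) (G n β) ≡ G n β
isobaric-when {G} {n} iso β with level β ≡ᵇ n in eq
... | true  = refl
... | false = sym (iso β (λ lev≡n → subst T eq (ℕₚ.≡⇒≡ᵇ (level β) n lev≡n)))

oneCoeffs-isobaric : ∀ m → IsobaricAt oneCoeffs m
oneCoeffs-isobaric zero    γ lev≢0 = when-≡0 (allZero γ) (λ az → contradiction (allZero⇒levelFrom≡0 1 γ az) lev≢0)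
oneCoeffs-isobaric (suc m) γ _     = refl

mulLinear-isobaric : ∀ c G n → (∀ {m} → m < n → IsobaricAt G m) → IsobaricAt (mulLinear c G) n
mulLinear-isobaric c G n iso γ lev≢n = ∑<-zero n (λ j j<n → when-≡0 (hasVar j γ) (λ hv →
  trans (cong (c j *_) (iso (∸-suc< j<n) (dec j γ) (λ e → lev≢n (level≡ j<n hv e))))
        (ℚₚ.*-zeroʳ (c j))))
  where
    level≡ : ∀ {j} → j < n → T (hasVar j γ) → level (dec j γ) ≡ n ∸ suc j → level γ ≡ n
    level≡ {j} j<n hv e = begin
      level γ                  ≡⟨ sym (level-dec j γ hv) ⟩
      level (dec j γ) ℕ.+ suc j ≡⟨ cong (ℕ._+ suc j) e ⟩
      n ∸ suc j ℕ.+ suc j       ≡⟨ ℕₚ.m∸n+n≡m j<n ⟩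
      n                        ∎

-- Geometric series of a linear series

module Geometric (c : ℕ → ℚ) (q : Series) (q-linear : ∀ k → q k ≡ linearSeries c k) where

  R : Coeffs
  R = coeffs (recipOneMinus q)

  coeffs-^S-suc : ∀ k m β → coeffs (q ^S suc k) m β ≡ mulLinear c (coeffs (q ^S k)) m β
  coeffs-^S-suc k m β = trans (cong (λ f → coeff f β) (*S-congˡ q-linear (q ^S k) m))
                              (coeffs-linearSeries-*S c (q ^S k) m β)

  coeffs-^S-< : ∀ k m β → m < k → coeffs (q ^S k) m β ≡ 0ℚ
  coeffs-^S-< (suc k) m β (s≤s m≤k) = trans (coeffs-^S-suc k m β) (∑<-zero m (λ j j<m →
    when-≡0 (hasVar j β) (λ _ →
      trans (cong (c j *_) (coeffs-^S-< k (m ∸ suc j) (dec j β) (ℕₚ.<-≤-trans (∸-suc< j<m) m≤k)))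
            (ℚₚ.*-zeroʳ (c j)))))

  R-∑ : ∀ M m β → m < M → ∑[ k < M ] coeffs (q ^S k) m β ≡ R m β
  R-∑ M m β m<M = begin
    ∑[ k < M ] coeffs (q ^S k) m β
      ≡⟨ ∑<-bounded M (suc m) (λ k M≤k → coeffs-^S-< k m β (ℕₚ.<-≤-trans m<M M≤k))
                              (λ k → coeffs-^S-< k m β) ⟩
    ∑[ k < suc m ] coeffs (q ^S k) m β
      ≡⟨ sym (∑ˡ-applyUpTo (λ k → k) (suc m) (λ k → coeffs (q ^S k) m β)) ⟩
    ∑ˡ (upTo (suc m)) (λ k → coeffs (q ^S k) m β)
      ≡⟨ sym (coeff-sumP (λ k → (q ^S k) m) (upTo (suc m)) β) ⟩
    R m β ∎

  R-rec : ∀ m β → R m β ≡ oneCoeffs m β + mulLinear c R m β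
  R-rec m β = begin
    R m β
      ≡⟨ sym (R-∑ (suc m) m β ℕₚ.≤-refl) ⟩
    coeffs (q ^S 0) m β + ∑[ k < m ] coeffs (q ^S suc k) m β
      ≡⟨ cong₂ _+_ (coeffs-oneS m β) (∑<-cong m (λ k _ → coeffs-^S-suc k m β)) ⟩
    oneCoeffs m β + ∑[ k < m ] mulLinear c (coeffs (q ^S k)) m β
      ≡⟨ cong (oneCoeffs m β +_) (sym (mulLinear-∑ c m (λ k → coeffs (q ^S k)) m β)) ⟩
    oneCoeffs m β + mulLinear c (λ m′ γ → ∑[ k < m ] coeffs (q ^S k) m′ γ) m β
      ≡⟨ cong (oneCoeffs m β +_) (mulLinear-cong c m β (R-∑ m)) ⟩
    oneCoeffs m β + mulLinear c R m β ∎

  R-isobaric : ∀ m → IsobaricAt R m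
  R-isobaric = <-rec (IsobaricAt R) λ m rec γ lev≢m → begin
    R m γ                              ≡⟨ R-rec m γ ⟩
    oneCoeffs m γ + mulLinear c R m γ
      ≡⟨ cong₂ _+_ (oneCoeffs-isobaric m γ lev≢m) (mulLinear-isobaric c R m rec γ lev≢m) ⟩
    0ℚ + 0ℚ                            ≡⟨ ℚₚ.+-identityˡ 0ℚ ⟩
    0ℚ                                 ∎

  module Quotient (d : ℕ → ℚ) (s : Series) (s-linear : ∀ k → s k ≡ linearSeries d k) where

    F : Coeffs
    F = coeffs (s *S recipOneMinus q)

    F≡mulLinear : ∀ n β → F n β ≡ mulLinear d R n β
    F≡mulLinear n β = trans (cong (λ f → coeff f β) (*S-congˡ s-linear (recipOneMinus q) n))
                            (coeffs-linearSeries-*S d (recipOneMinus q) n β)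

    F-rec : ∀ n β → F n β ≡ mulLinear d oneCoeffs n β + mulLinear c F n β
    F-rec n β = begin
      F n β
        ≡⟨ F≡mulLinear n β ⟩
      mulLinear d R n β
        ≡⟨ mulLinear-cong d n β (λ m γ _ → R-rec m γ) ⟩
      mulLinear d (λ m γ → oneCoeffs m γ + mulLinear c R m γ) n β
        ≡⟨ mulLinear-+ d oneCoeffs (mulLinear c R) n β ⟩
      mulLinear d oneCoeffs n β + mulLinear d (mulLinear c R) n β
        ≡⟨ cong (mulLinear d oneCoeffs n β +_) (sym (mulLinear-comm c d R n β)) ⟩
      mulLinear d oneCoeffs n β + mulLinear c (mulLinear d R) n β
        ≡⟨ cong (mulLinear d oneCoeffs n β +_) (mulLinear-cong c n β (λ m γ _ → sym (F≡mulLinear m γ))) ⟩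
      mulLinear d oneCoeffs n β + mulLinear c F n β ∎

    F-isobaric : ∀ n → IsobaricAt F n
    F-isobaric n γ lev≢n =
      trans (F≡mulLinear n γ) (mulLinear-isobaric d R n (λ {m} _ → R-isobaric m) γ lev≢n)

-- The recursion defining A_ω

support-∑ : ∀ α (f : ℕ → ℚ) → sumℚ (map f (support α)) ≡ ∑[ i < level α ] when (hasVar i α) (f i)
support-∑ α f = begin
  ∑ˡ (filterᵇ (λ i → hasVar i α) (upTo (length α))) f
    ≡⟨ ∑ˡ-filterᵇ (λ i → hasVar i α) (upTo (length α)) f ⟩
  ∑ˡ (upTo (length α)) (λ i → when (hasVar i α) (f i))
    ≡⟨ ∑ˡ-applyUpTo (λ i → i) (length α) (λ i → when (hasVar i α) (f i)) ⟩
  ∑[ i < length α ] when (hasVar i α) (f i)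
    ≡⟨ ∑<-bounded (length α) (level α) (vanishes (λ i → hasVar⇒<length i α))
                                       (vanishes (λ i → hasVar⇒<level i α)) ⟩
  ∑[ i < level α ] when (hasVar i α) (f i) ∎
  where
    vanishes : ∀ {n} → (∀ i → T (hasVar i α) → i < n) → ∀ k → n ≤ k → when (hasVar k α) (f k) ≡ 0ℚ
    vanishes bound k n≤k = when-≡0 (hasVar k α) (λ hv → contradiction n≤k (ℕₚ.<⇒≱ (bound k hv)))

oneCoeffs-level : ∀ δ → oneCoeffs (level δ) δ ≡ when (allZero δ) 1ℚ
oneCoeffs-level δ with level δ in eq
... | zero  = refl
... | suc m = sym (when-≡0 (allZero δ) (λ az → contradiction (trans (sym eq) (allZero⇒levelFrom≡0 1 δ az)) λ ()))

open Geometric (λ _ → 1ℚ) pS pS-linear using (module Quotient)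

module _ (ω : Weight) where

  open Quotient (ω ∘ suc) (numS ω) (numS-linear ω)

  F-summand : Monomial → ℕ → ℚ
  F-summand α j = when (allZero (dec j α)) (ω (suc j)) + F (level (dec j α)) (dec j α)

  F-level-rec : ∀ α → F (level α) α ≡ ∑[ j < level α ] when (hasVar j α) (F-summand α j)
  F-level-rec α = begin
    F n α
      ≡⟨ F-rec n α ⟩
    mulLinear (ω ∘ suc) oneCoeffs n α + mulLinear (λ _ → 1ℚ) F n α
      ≡⟨ sym (∑<-+ n (λ j → when (v j) (x j)) (λ j → when (v j) (y j))) ⟩
    ∑[ j < n ] (when (v j) (x j) + when (v j) (y j))
      ≡⟨ ∑<-cong n (λ j _ → sym (when-+ (v j) (x j) (y j))) ⟩
    ∑[ j < n ] when (v j) (x j + y j)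
      ≡⟨ ∑<-cong n (λ j _ → when-congᵗ (v j) (summand j)) ⟩
    ∑[ j < n ] when (v j) (F-summand α j) ∎
    where
      n = level α
      v : ℕ → Bool
      v j = hasVar j α
      x y : ℕ → ℚ
      x j = ω (suc j) * oneCoeffs (n ∸ suc j) (dec j α)
      y j = 1ℚ * F (n ∸ suc j) (dec j α)
      summand : ∀ j → T (v j) → x j + y j ≡ F-summand α j
      summand j hv = begin
        ω (suc j) * oneCoeffs (n ∸ suc j) δ + 1ℚ * F (n ∸ suc j) δ
          ≡⟨ cong (λ m → ω (suc j) * oneCoeffs m δ + 1ℚ * F m δ) (sym (level-dec-∸ j α hv)) ⟩
        ω (suc j) * oneCoeffs (level δ) δ + 1ℚ * F (level δ) δ
          ≡⟨ cong₂ _+_ (cong (ω (suc j) *_) (oneCoeffs-level δ)) (ℚₚ.*-identityˡ (F (level δ) δ)) ⟩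
        ω (suc j) * when (allZero δ) 1ℚ + F (level δ) δ
          ≡⟨ cong (_+ F (level δ) δ) (*-when (allZero δ) (ω (suc j)) 1ℚ) ⟩
        when (allZero δ) (ω (suc j) * 1ℚ) + F (level δ) δ
          ≡⟨ cong (λ z → when (allZero δ) z + F (level δ) δ) (ℚₚ.*-identityʳ (ω (suc j))) ⟩
        when (allZero δ) (ω (suc j)) + F (level δ) δ ∎
        where δ = dec j α

  Afuel≡F : ∀ s α → size α ≡ suc s → Afuel ω (suc s) α ≡ F (level α) α
  Afuel≡F zero α hs rewrite hs = begin
    sumℚ (map (ω ∘ suc) (support α))
      ≡⟨ support-∑ α (ω ∘ suc) ⟩
    ∑[ j < level α ] when (hasVar j α) (ω (suc j))
      ≡⟨ ∑<-cong (level α) (λ j _ → when-congᵗ (hasVar j α) (summand j)) ⟩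
    ∑[ j < level α ] when (hasVar j α) (F-summand α j)
      ≡⟨ sym (F-level-rec α) ⟩
    F (level α) α ∎
    where
      summand : ∀ j → T (hasVar j α) → ω (suc j) ≡ F-summand α j
      summand j hv = begin
        ω (suc j)
          ≡⟨ sym (ℚₚ.+-identityʳ (ω (suc j))) ⟩
        when true (ω (suc j)) + F 0 δ
          ≡⟨ cong₂ (λ b m → when b (ω (suc j)) + F m δ) allZero-δ (sym level-δ) ⟩
        when (allZero δ) (ω (suc j)) + F (level δ) δ ∎
        where
          δ = dec j α
          size-δ : size δ ≡ 0
          size-δ = ℕₚ.suc-injective (trans (size-dec j α hv) hs)
          allZero-δ : true ≡ allZero δ
          allZero-δ = sym (trans (allZero-size δ) (cong (_≡ᵇ 0) size-δ))
          level-δ : level δ ≡ 0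
          level-δ = size≡0⇒level≡0 δ size-δ
  Afuel≡F (suc s) α hs rewrite hs = begin
    sumℚ (map (λ i → Afuel ω (suc s) (dec i α)) (support α))
      ≡⟨ support-∑ α (λ i → Afuel ω (suc s) (dec i α)) ⟩
    ∑[ j < level α ] when (hasVar j α) (Afuel ω (suc s) (dec j α))
      ≡⟨ ∑<-cong (level α) (λ j _ → when-congᵗ (hasVar j α) (summand j)) ⟩
    ∑[ j < level α ] when (hasVar j α) (F-summand α j)
      ≡⟨ sym (F-level-rec α) ⟩
    F (level α) α ∎
    where
      summand : ∀ j → T (hasVar j α) → Afuel ω (suc s) (dec j α) ≡ F-summand α j
      summand j hv = begin
        Afuel ω (suc s) δ
          ≡⟨ Afuel≡F s δ size-δ ⟩
        F (level δ) δ
          ≡⟨ sym (ℚₚ.+-identityˡ (F (level δ) δ)) ⟩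
        when false (ω (suc j)) + F (level δ) δ
          ≡⟨ cong (λ b → when b (ω (suc j)) + F (level δ) δ) allZero-δ ⟩
        when (allZero δ) (ω (suc j)) + F (level δ) δ ∎
        where
          δ = dec j α
          size-δ : size δ ≡ suc s
          size-δ = ℕₚ.suc-injective (trans (size-dec j α hv) hs)
          allZero-δ : false ≡ allZero δ
          allZero-δ = sym (trans (allZero-size δ) (cong (_≡ᵇ 0) size-δ))

  A≡F : ∀ α → A ω α ≡ F (level α) α
  A≡F α with size α in hs
  ... | zero  = cong (λ m → F m α) (sym (size≡0⇒level≡0 α hs))
  ... | suc s = Afuel≡F s α hs

-- Enumerating partitions

-- vecs l b lists every exponent vector of length l with entries ≤ b exactly once; fits l b β
-- says that β is one of them up to trailing zeros, and trunc l β is that representative.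
fits : ℕ → ℕ → Monomial → Bool
fits zero    b β = allZero β
fits (suc l) b β = (lookup0 β 0 <ᵇ suc b) ∧ fits l b (drop 1 β)

trunc : ℕ → Monomial → Monomial
trunc zero    β = []
trunc (suc l) β = lookup0 β 0 ∷ trunc l (drop 1 β)

∑ˡ-vecs : ∀ l b β (h : Monomial → ℚ) →
          ∑ˡ (vecs l b) (λ α → when (sameMono α β) (h α)) ≡ when (fits l b β) (h (trunc l β))
∑ˡ-vecs zero    b β h = ℚₚ.+-identityʳ _
∑ˡ-vecs (suc l) b β h = begin
  ∑ˡ (concatMap (λ a → map (a ∷_) (vecs l b)) (upTo (suc b))) S
    ≡⟨ ∑ˡ-concatMap (λ a → map (a ∷_) (vecs l b)) (upTo (suc b)) S ⟩
  ∑ˡ (upTo (suc b)) (λ a → ∑ˡ (map (a ∷_) (vecs l b)) S)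
    ≡⟨ ∑ˡ-applyUpTo (λ a → a) (suc b) (λ a → ∑ˡ (map (a ∷_) (vecs l b)) S) ⟩
  ∑[ a < suc b ] ∑ˡ (map (a ∷_) (vecs l b)) S
    ≡⟨ ∑<-cong (suc b) (λ a _ → row a) ⟩
  ∑[ a < suc b ] when (a ≡ᵇ c) (when (fits l b β′) (h (a ∷ trunc l β′)))
    ≡⟨ ∑<-indicator (suc b) c (λ a → when (fits l b β′) (h (a ∷ trunc l β′))) ⟩
  when (c <ᵇ suc b) (when (fits l b β′) (h (c ∷ trunc l β′)))
    ≡⟨ sym (when-∧ (c <ᵇ suc b) (fits l b β′) (h (c ∷ trunc l β′))) ⟩
  when (fits (suc l) b β) (h (trunc (suc l) β)) ∎
  where
    c  = lookup0 β 0
    β′ = drop 1 β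
    S : Monomial → ℚ
    S α = when (sameMono α β) (h α)
    row : ∀ a → ∑ˡ (map (a ∷_) (vecs l b)) S ≡ when (a ≡ᵇ c) (when (fits l b β′) (h (a ∷ trunc l β′)))
    row a = begin
      ∑ˡ (map (a ∷_) (vecs l b)) S
        ≡⟨ ∑ˡ-map (a ∷_) (vecs l b) S ⟩
      ∑ˡ (vecs l b) (λ α → when (sameMono (a ∷ α) β) (h (a ∷ α)))
        ≡⟨ ∑ˡ-cong (vecs l b) (λ α → trans (cong (λ s → when s (h (a ∷ α))) (sameMono-∷ a α β))
                                           (when-∧ (a ≡ᵇ c) (sameMono α β′) (h (a ∷ α)))) ⟩
      ∑ˡ (vecs l b) (λ α → when (a ≡ᵇ c) (when (sameMono α β′) (h (a ∷ α))))
        ≡⟨ sym (when-∑ˡ (a ≡ᵇ c) (vecs l b) (λ α → when (sameMono α β′) (h (a ∷ α)))) ⟩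
      when (a ≡ᵇ c) (∑ˡ (vecs l b) (λ α → when (sameMono α β′) (h (a ∷ α))))
        ≡⟨ cong (when (a ≡ᵇ c)) (∑ˡ-vecs l b β′ (h ∘ (a ∷_))) ⟩
      when (a ≡ᵇ c) (when (fits l b β′) (h (a ∷ trunc l β′))) ∎

trunc-sameMono : ∀ l b β → T (fits l b β) → T (sameMono (trunc l β) β)
trunc-sameMono zero    b β fits-β = fits-β
trunc-sameMono (suc l) b β fits-β = subst T (sym (sameMono-∷ c (trunc l (drop 1 β)) β))
  (Equivalence.from T-∧ (ℕₚ.≡⇒≡ᵇ c c refl , trunc-sameMono l b (drop 1 β) (proj₂ (Equivalence.to T-∧ fits-β))))
  where c = lookup0 β 0

levelFrom<⇒allZero : ∀ j β → levelFrom (suc j) β < suc j → T (allZero β)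
levelFrom<⇒allZero j []          _  = _
levelFrom<⇒allZero j (zero ∷ β)  lt = levelFrom<⇒allZero (suc j) β
  (ℕₚ.m<n⇒m<1+n (subst (_< suc j) (cong (ℕ._+ levelFrom (suc (suc j)) β) (ℕₚ.*-zeroʳ (suc j))) lt))
levelFrom<⇒allZero j (suc c ∷ β) lt =
  contradiction lt (ℕₚ.≤⇒≯ (ℕₚ.≤-trans (ℕₚ.m≤m*n (suc j) (suc c)) (ℕₚ.m≤m+n _ _)))

fits-levelFrom : ∀ l b j β → levelFrom (suc j) β ≤ b → levelFrom (suc j) β < suc j ℕ.+ l → T (fits l b β)
fits-levelFrom zero    b j β        _  lt =
  levelFrom<⇒allZero j β (subst (levelFrom (suc j) β <_) (ℕₚ.+-identityʳ (suc j)) lt)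
fits-levelFrom (suc l) b j []       _  _  = fits-levelFrom l b (suc j) [] z≤n ℕ.z<s
fits-levelFrom (suc l) b j (c ∷ cs) le lt = Equivalence.from T-∧
  ( ℕₚ.<⇒<ᵇ (s≤s (ℕₚ.≤-trans (ℕₚ.m≤n*m c (suc j)) (ℕₚ.≤-trans (ℕₚ.m≤m+n _ _) le)))
  , fits-levelFrom l b (suc j) cs (ℕₚ.≤-trans (ℕₚ.m≤n+m _ _) le)
      (ℕₚ.≤-<-trans (ℕₚ.m≤n+m _ (suc j ℕ.* c)) (subst (levelFrom (suc j) (c ∷ cs) <_) (ℕₚ.+-suc (suc j) l) lt)))

fits-level : ∀ N β → level β ≡ N → T (fits N N β)
fits-level N β lev = fits-levelFrom N N 0 β (ℕₚ.≤-reflexive lev) (s≤s (ℕₚ.≤-reflexive lev))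

coeff-P : ∀ ω N β → coeff (P N ω) β ≡ when (level β ≡ᵇ N) (A ω (trunc N β))
coeff-P ω N β = begin
  coeff (map (λ α → (A ω α , α)) (filterᵇ (λ α → level α ≡ᵇ N) (vecs N N))) β
    ≡⟨ coeff-terms (A ω) (filterᵇ (λ α → level α ≡ᵇ N) (vecs N N)) β ⟩
  ∑ˡ (filterᵇ (λ α → level α ≡ᵇ N) (vecs N N)) (λ α → when (sameMono α β) (A ω α))
    ≡⟨ ∑ˡ-filterᵇ (λ α → level α ≡ᵇ N) (vecs N N) (λ α → when (sameMono α β) (A ω α)) ⟩
  ∑ˡ (vecs N N) (λ α → when (level α ≡ᵇ N) (when (sameMono α β) (A ω α)))
    ≡⟨ ∑ˡ-cong (vecs N N) swap ⟩
  ∑ˡ (vecs N N) (λ α → when (sameMono α β) (when (level β ≡ᵇ N) (A ω α)))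
    ≡⟨ ∑ˡ-vecs N N β (λ α → when (level β ≡ᵇ N) (A ω α)) ⟩
  when (fits N N β) (when (level β ≡ᵇ N) (A ω (trunc N β)))
    ≡⟨ when-absorb (fits N N β) (level β ≡ᵇ N) _ (fits-level N β ∘ ℕₚ.≡ᵇ⇒≡ (level β) N) ⟩
  when (level β ≡ᵇ N) (A ω (trunc N β)) ∎
  where
    swap : ∀ α → when (level α ≡ᵇ N) (when (sameMono α β) (A ω α)) ≡
                 when (sameMono α β) (when (level β ≡ᵇ N) (A ω α))
    swap α with sameMono α β in same
    ... | false = when-0 (level α ≡ᵇ N)
    ... | true  = cong (λ m → when (m ≡ᵇ N) (A ω α)) (levelFrom-cong 1 α β (subst T (sym same) _))

theorem9 : (ω : Weight) → genP ω ≈S (numS ω *S recipOneMinus pS)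
theorem9 ω zero    β = refl
theorem9 ω (suc n) β = begin
  coeff (P N ω) β                        ≡⟨ coeff-P ω N β ⟩
  when (level β ≡ᵇ N) (A ω (trunc N β))  ≡⟨ when-congᵗ (level β ≡ᵇ N) (A-trunc ∘ ℕₚ.≡ᵇ⇒≡ (level β) N) ⟩
  when (level β ≡ᵇ N) (F N β)            ≡⟨ isobaric-when {F} {N} (F-isobaric N) β ⟩
  F N β                                  ∎
  where
    N = suc n
    open Quotient (ω ∘ suc) (numS ω) (numS-linear ω)
    A-trunc : level β ≡ N → A ω (trunc N β) ≡ F N β
    A-trunc lev = begin
      A ω (trunc N β)                    ≡⟨ A≡F ω (trunc N β) ⟩
      F (level (trunc N β)) (trunc N β)  ≡⟨ cong (λ m → F m (trunc N β)) level-trunc ⟩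
      F N (trunc N β)                    ≡⟨ coeff-congʳ ((numS ω *S recipOneMinus pS) N) same ⟩
      F N β                              ∎
      where
        same : T (sameMono (trunc N β) β)
        same = trunc-sameMono N N β (fits-level N β lev)
        level-trunc : level (trunc N β) ≡ N
        level-trunc = trans (levelFrom-cong 1 (trunc N β) β same) lev
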